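{- Let $R$ be a ring containing no nonzero nilpotent elements. Let $\Phi$ be an $R$-valued graph invariant that is multiplicative and satisfies inclusion-exclusion. Then $\Phi(G) = v(G)\cdot 1_R$ for every graph $G$, where $v(G)$ is the number of vertices of $G$.
   Context: A graph means a finite undirected graph with no loops or multiple edges; it may be disconnected, and the empty graph $\emptyset$ is allowed. An $R$-valued graph invariant is a function $\Phi$ assigning to each graph $G$ an element $\Phi(G)\in R$, such that $\Phi(G)=\Phi(H)$ whenever $G\cong H$. It is multiplicative if $\Phi(K_1)=1$ (where $K_1$ is the one-vertex graph) and $\Phi(G\,\Box\,H)=\Phi(G)\Phi(H)$ for all graphs $G,H$. Here $G\,\Box\,H$ is the cartesian product: its vertex set is $V(G)\times V(H)$, and $(x,y)$ is adjacent to $(x',y')$ iff either $x=x'$ and $\{y,y'\}\in E(H)$, or $y=y'$ and $\{x,x'\}\in E(G)$. It satisfies inclusion-exclusion if $\Phi(\emptyset)=0$ and $\Phi(X)=\Phi(G)+\Phi(H)-\Phi(G\cap H)$ whenever $G,H$ are subgraphs of a graph $X$ with $G\cup H=X$. Unions and intersections of subgraphs are taken on both vertex sets and edge sets. -}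

module Defs where

open import Level using (Level; _⊔_)
open import Data.Nat using (ℕ)
open import Data.Fin using (Fin)
open import Data.Fin.Properties using (*↔×)
open import Data.Product using (Σ; ∃; _×_; _,_; proj₁; proj₂)
open import Data.Product.Function.NonDependent.Propositional using (_×-↔_)
open import Data.Sum using (_⊎_; inj₁; inj₂)
open import Data.Empty using (⊥)
open import Data.Unit using (⊤)
open import Relation.Nullary using (¬_)
open import Relation.Binary.PropositionalEquality using (_≡_; refl; sym)
open import Function using (Injective)
open import Function.Bundles using (_↔_; _⇔_; Inverse)
open import Function.Properties.Inverse using (↔-sym; ↔-trans)
open import Algebra.Bundles using (Ring; Semiring)
import Function.Construct.Identity as FId
import Algebra.Definitions.RawSemiring as RSDefs

-- No loops (irrefl), no multiple edges (edges are a relation).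

record Graph : Set₁ where
  field
    V      : Set
    size   : ℕ
    enum   : V ↔ Fin size
    Adj    : V → V → Set
    Adj-sym    : ∀ {x y} → Adj x y → Adj y x
    Adj-irrefl : ∀ {x} → ¬ Adj x x

open Graph public

v : Graph → ℕ
v G = size G

_≅_ : Graph → Graph → Set
G ≅ H = Σ (V G ↔ V H) λ f →
          ∀ x y → Adj G x y ⇔ Adj H (Inverse.to f x) (Inverse.to f y)

∅G : Graph
∅G = record
  { V = Fin 0 ; size = 0 ; enum = FId.↔-id (Fin 0)
  ; Adj = λ _ _ → ⊥ ; Adj-sym = λ () ; Adj-irrefl = λ () }

K₁ : Graph
K₁ = record
  { V = Fin 1 ; size = 1 ; enum = FId.↔-id (Fin 1)
  ; Adj = λ _ _ → ⊥ ; Adj-sym = λ () ; Adj-irrefl = λ () }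

_□_ : Graph → Graph → Graph
G □ H = record
  { V = V G × V H
  ; size = size G Data.Nat.* size H
  ; enum = ↔-trans (enum G ×-↔ enum H) (↔-sym *↔×)
  ; Adj = λ { (x , y) (x′ , y′) →
              (x ≡ x′ × Adj H y y′) ⊎ (y ≡ y′ × Adj G x x′) }
  ; Adj-sym = λ { (inj₁ (refl , a)) → inj₁ (refl , Adj-sym H a)
                ; (inj₂ (refl , a)) → inj₂ (refl , Adj-sym G a) }
  ; Adj-irrefl = λ { (inj₁ (_ , a)) → Adj-irrefl H a
                   ; (inj₂ (_ , a)) → Adj-irrefl G a }
  }

record Subgraph (X : Graph) : Set₁ where
  field
    Vs : V X → Set
    Es : V X → V X → Set
    Es-sym  : ∀ {x y} → Es x y → Es y x
    Es-adj  : ∀ {x y} → Es x y → Adj X x y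
    Es-ends : ∀ {x y} → Es x y → Vs x

open Subgraph public

_∪S_ : ∀ {X} → Subgraph X → Subgraph X → Subgraph X
G ∪S H = record
  { Vs = λ x → Vs G x ⊎ Vs H x
  ; Es = λ x y → Es G x y ⊎ Es H x y
  ; Es-sym  = λ { (inj₁ e) → inj₁ (Es-sym G e) ; (inj₂ e) → inj₂ (Es-sym H e) }
  ; Es-adj  = λ { (inj₁ e) → Es-adj G e ; (inj₂ e) → Es-adj H e }
  ; Es-ends = λ { (inj₁ e) → inj₁ (Es-ends G e) ; (inj₂ e) → inj₂ (Es-ends H e) }
  }

_∩S_ : ∀ {X} → Subgraph X → Subgraph X → Subgraph X
G ∩S H = record
  { Vs = λ x → Vs G x × Vs H x
  ; Es = λ x y → Es G x y × Es H x y
  ; Es-sym  = λ { (e , f) → Es-sym G e , Es-sym H f }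
  ; Es-adj  = λ { (e , f) → Es-adj G e }
  ; Es-ends = λ { (e , f) → Es-ends G e , Es-ends H f }
  }

IsWhole : ∀ {X} → Subgraph X → Set
IsWhole {X} S = (∀ x → Vs S x) × (∀ x y → Adj X x y → Es S x y)

-- A graph G "is" the subgraph S of X (up to isomorphism): there is an
-- injective map V G → V X whose image is exactly the vertex set of S and
-- under which the adjacency of G is exactly the edge set of S.
Realizes : ∀ {X} → Graph → Subgraph X → Set
Realizes {X} G S = Σ (V G → V X) λ ι →
    Injective _≡_ _≡_ ι
  × (∀ x → Vs S x ⇔ ∃ λ a → ι a ≡ x)
  × (∀ a b → Adj G a b ⇔ Es S (ι a) (ι b))

module _ {c ℓ} (R : Ring c ℓ) where
  open Ring R
  open RSDefs (Semiring.rawSemiring semiring) using (_^_) renaming (_×_ to _·ℕ_)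

  Reduced : Set (c ⊔ ℓ)
  Reduced = ∀ (x : Carrier) (n : ℕ) → x ^ n ≈ 0# → x ≈ 0#

  IsInvariant : (Graph → Carrier) → Set _
  IsInvariant Φ = ∀ G H → G ≅ H → Φ G ≈ Φ H

  IsMultiplicative : (Graph → Carrier) → Set _
  IsMultiplicative Φ = (Φ K₁ ≈ 1#) × (∀ G H → Φ (G □ H) ≈ Φ G * Φ H)

  -- Inclusion–exclusion: Φ(∅) = 0 and for subgraphs G, H of X with
  -- G ∪ H = X, Φ(X) = Φ(G) + Φ(H) - Φ(G ∩ H), where the subgraphs
  -- are evaluated via any graphs realizing them.
  InclusionExclusion : (Graph → Carrier) → Set _
  InclusionExclusion Φ =
      (Φ ∅G ≈ 0#)
    × (∀ (X : Graph) (S T : Subgraph X) (G H I : Graph) →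
         IsWhole (S ∪S T) →
         Realizes G S → Realizes H T → Realizes I (S ∩S T) →
         Φ X ≈ (Φ G + Φ H) - Φ I)

  vertexCount : Graph → Carrier
  vertexCount G = v G ·ℕ 1#

module Submission where

-- 1. Edgeless graphs.  The edgeless graph on n + 1 vertices is the disjoint
--    union of K₁ and the edgeless graph on n vertices, so inclusion–exclusion
--    and Φ(∅) = 0 give Φ(edgeless on n vertices) = n·1 by induction on n.
-- 2. A product rule.  The edges of G □ H split into "horizontal" edges (along
--    G) and "vertical" edges (along H).  The two spanning subgraphs they form
--    are G □ Ē_H and Ē_G □ H, meeting in the edgeless graph on V G × V H
--    (Ē_X denotes the edgeless graph on the vertices of X).  With
--    multiplicativity this yields, writing m_X = v(X)·1,
--        Φ(G □ H) = Φ(G)·m_H + m_G·Φ(H) − m_G·m_H.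
-- 3. Taking H = G and Φ(G □ G) = Φ(G)², the element x = Φ(G) − m_G satisfies
--    x² = 0; as the ring is reduced, x = 0.

open import Defs
open import Level using (Level)
open import Algebra.Bundles using (Ring; Semiring)
open import Data.Nat using (ℕ; zero; suc)
open import Data.Fin using (Fin; zero; suc)
open import Data.Fin.Properties using (suc-injective)
open import Data.Product using (∃; _,_; proj₁; proj₂) renaming (_×_ to _⊗_)
open import Data.Sum using (inj₁; inj₂)
open import Data.Empty using (⊥)
open import Data.Unit using (⊤; tt)
open import Relation.Binary.PropositionalEquality as P using (_≡_)
open import Function using (id)
open import Function.Bundles using (_↔_; mk⇔)
import Function.Construct.Identity as FId
import Algebra.Definitions.RawSemiring as RSDefs
import Algebra.Properties.Ring as RingProperties
import Algebra.Properties.CommutativeSemigroup as CSemigroupProperties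
import Algebra.Properties.Semiring.Mult as SemiringMult
import Relation.Binary.Reasoning.Setoid as SetoidReasoning

Edgeless : (A : Set) (n : ℕ) → A ↔ Fin n → Graph
Edgeless A n e = record
  { V = A ; size = n ; enum = e
  ; Adj = λ _ _ → ⊥ ; Adj-sym = λ () ; Adj-irrefl = λ () }

Ē : ℕ → Graph
Ē n = Edgeless (Fin n) n (FId.↔-id (Fin n))

-- Any two edgeless graphs of the same size are isomorphic (via the
-- enumeration); this lets invariance reduce every edgeless graph to Ē n.
Edgeless≅Ē : ∀ A n (e : A ↔ Fin n) → Edgeless A n e ≅ Ē n
Edgeless≅Ē A n e = e , λ _ _ → mk⇔ (λ ()) (λ ())

verticesOf : Graph → Graph
verticesOf G = Edgeless (V G) (size G) (enum G)

module PointSplit (n : ℕ) where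

  Point : Subgraph (Ē (suc n))
  Point = record
    { Vs = λ x → zero ≡ x ; Es = λ _ _ → ⊥
    ; Es-sym = λ () ; Es-adj = λ () ; Es-ends = λ () }

  Rest : Subgraph (Ē (suc n))
  Rest = record
    { Vs = λ x → ∃ λ (a : Fin n) → suc a ≡ x ; Es = λ _ _ → ⊥
    ; Es-sym = λ () ; Es-adj = λ () ; Es-ends = λ () }

  covers : IsWhole (Point ∪S Rest)
  covers = (λ { zero → inj₁ P.refl ; (suc a) → inj₂ (a , P.refl) }) , λ _ _ ()

  point-realized : Realizes K₁ Point
  point-realized =
      (λ _ → zero) , (λ { {zero} {zero} _ → P.refl })
    , (λ _ → mk⇔ (λ p → zero , p) proj₂) , (λ _ _ → mk⇔ (λ ()) (λ ()))

  rest-realized : Realizes (Ē n) Rest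
  rest-realized =
    suc , suc-injective , (λ _ → mk⇔ id id) , (λ _ _ → mk⇔ (λ ()) (λ ()))

  disjoint : Realizes ∅G (Point ∩S Rest)
  disjoint =
      (λ ()) , (λ { {()} })
    , (λ _ → mk⇔ (λ { (P.refl , (_ , ())) }) (λ { (() , _) })) , λ ()

module ProductSplit (G H : Graph) where

  Horizontal : Subgraph (G □ H)
  Horizontal = record
    { Vs = λ _ → ⊤
    ; Es = λ p q → proj₂ p ≡ proj₂ q ⊗ Adj G (proj₁ p) (proj₁ q)
    ; Es-sym = λ { (e , a) → P.sym e , Adj-sym G a }
    ; Es-adj = inj₂ ; Es-ends = λ _ → tt }

  Vertical : Subgraph (G □ H)
  Vertical = record
    { Vs = λ _ → ⊤
    ; Es = λ p q → proj₁ p ≡ proj₁ q ⊗ Adj H (proj₂ p) (proj₂ q)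
    ; Es-sym = λ { (e , a) → P.sym e , Adj-sym H a }
    ; Es-adj = inj₁ ; Es-ends = λ _ → tt }

  covers : IsWhole (Horizontal ∪S Vertical)
  covers = (λ _ → inj₁ tt) , λ _ _ → λ { (inj₁ a) → inj₂ a ; (inj₂ a) → inj₁ a }

  horizontal-realized : Realizes (G □ verticesOf H) Horizontal
  horizontal-realized =
      id , id , (λ p → mk⇔ (λ _ → p , P.refl) (λ _ → tt))
    , (λ _ _ → mk⇔ (λ { (inj₁ (_ , ())) ; (inj₂ e) → e }) inj₂)

  vertical-realized : Realizes (verticesOf G □ H) Vertical
  vertical-realized =
      id , id , (λ p → mk⇔ (λ _ → p , P.refl) (λ _ → tt))
    , (λ _ _ → mk⇔ (λ { (inj₂ (_ , ())) ; (inj₁ e) → e }) inj₁)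

  -- An edge both horizontal and vertical would be a loop of G.
  shared-realized : Realizes (verticesOf (G □ H)) (Horizontal ∩S Vertical)
  shared-realized =
      id , id , (λ p → mk⇔ (λ _ → p , P.refl) (λ _ → tt , tt))
    , (λ _ _ → mk⇔ (λ ()) (λ { ((_ , e) , (P.refl , _)) → Adj-irrefl G e }))

module RingFacts {c ℓ} (R : Ring c ℓ) where
  open Ring R
  open RingProperties R
  open CSemigroupProperties +-commutativeSemigroup using (xy∙z≈xz∙y)
  open SetoidReasoning setoid

  -- If x² = x·m + m·x − m² then (x − m)² = 0 (no commutativity needed).
  square-of-difference : ∀ x m → x * x ≈ (x * m + m * x) - m * m →
                         (x - m) * (x - m) ≈ 0#
  square-of-difference x m xx = begin
    (x - m) * (x - m)                             ≈⟨ [y-z]x≈yx-zx (x - m) x m ⟩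
    x * (x - m) - m * (x - m)                     ≈⟨ +-cong (x[y-z]≈xy-xz x x m)
                                                            (-‿cong (x[y-z]≈xy-xz m x m)) ⟩
    (x * x - x * m) - (m * x - m * m)             ≈⟨ +-congʳ (+-congʳ xx) ⟩
    ((xm + mx) - mm - xm) - (mx - mm)             ≈⟨ x≈y⇒x∙y⁻¹≈ε cancel-xm ⟩
    0# ∎
    where
    xm mx mm : Carrier
    xm = x * m
    mx = m * x
    mm = m * m
    cancel-xm : (xm + mx) - mm - xm ≈ mx - mm
    cancel-xm = trans (xy∙z≈xz∙y (xm + mx) (- mm) (- xm)) (+-congʳ (xyx⁻¹≈y xm mx))

  square-zero⇒zero : Reduced R → ∀ x → x * x ≈ 0# → x ≈ 0#
  square-zero⇒zero reduced x x²≈0 =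
    reduced x 2 (trans (*-congˡ (*-identityʳ x)) x²≈0)

module Consequences {c ℓ} (R : Ring c ℓ) (Φ : Graph → Ring.Carrier R)
  (invariant : IsInvariant R Φ) (multiplicative : IsMultiplicative R Φ)
  (incl-excl : InclusionExclusion R Φ) where
  open Ring R
  open RingProperties R using (-0#≈0#)
  open RSDefs (Semiring.rawSemiring semiring) using () renaming (_×_ to _·ℕ_)
  open SemiringMult semiring using (×1-homo-*)
  open SetoidReasoning setoid

  Φ-K₁ : Φ K₁ ≈ 1#
  Φ-K₁ = proj₁ multiplicative

  Φ-∅ : Φ ∅G ≈ 0#
  Φ-∅ = proj₁ incl-excl

  Φ-□ : ∀ G H → Φ (G □ H) ≈ Φ G * Φ H
  Φ-□ = proj₂ multiplicative

  Φ-Ē : ∀ n → Φ (Ē n) ≈ n ·ℕ 1#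
  Φ-Ē zero    = trans (invariant (Ē 0) ∅G (Edgeless≅Ē (Fin 0) 0 (FId.↔-id (Fin 0)))) Φ-∅
  Φ-Ē (suc n) = begin
    Φ (Ē (suc n))                  ≈⟨ proj₂ incl-excl (Ē (suc n)) Point Rest K₁ (Ē n) ∅G
                                        covers point-realized rest-realized disjoint ⟩
    (Φ K₁ + Φ (Ē n)) - Φ ∅G        ≈⟨ +-cong (+-cong Φ-K₁ (Φ-Ē n)) (-‿cong Φ-∅) ⟩
    (1# + n ·ℕ 1#) - 0#            ≈⟨ +-congˡ -0#≈0# ⟩
    (1# + n ·ℕ 1#) + 0#            ≈⟨ +-identityʳ _ ⟩
    suc n ·ℕ 1#                    ∎
    where open PointSplit n

  Φ-verticesOf : ∀ G → Φ (verticesOf G) ≈ vertexCount R G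
  Φ-verticesOf G =
    trans (invariant _ _ (Edgeless≅Ē (V G) (size G) (enum G))) (Φ-Ē (size G))

  Φ-product-rule : ∀ G H →
    Φ (G □ H) ≈ (Φ G * vertexCount R H + vertexCount R G * Φ H)
                - vertexCount R G * vertexCount R H
  Φ-product-rule G H = begin
    Φ (G □ H)                                   ≈⟨ proj₂ incl-excl (G □ H) Horizontal Vertical
                                                     _ _ _ covers horizontal-realized
                                                     vertical-realized shared-realized ⟩
    (Φ (G □ Ē-H) + Φ (Ē-G □ H)) - Φ (verticesOf (G □ H))
                                                ≈⟨ +-cong (+-cong horizontal vertical) (-‿cong shared) ⟩
    (Φ G * m H + m G * Φ H) - m G * m H         ∎
    where
    open ProductSplit G H
    m = vertexCount R
    Ē-G = verticesOf G
    Ē-H = verticesOf H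
    horizontal : Φ (G □ Ē-H) ≈ Φ G * m H
    horizontal = trans (Φ-□ G Ē-H) (*-congˡ (Φ-verticesOf H))
    vertical : Φ (Ē-G □ H) ≈ m G * Φ H
    vertical = trans (Φ-□ Ē-G H) (*-congʳ (Φ-verticesOf G))
    shared : Φ (verticesOf (G □ H)) ≈ m G * m H
    shared = trans (Φ-verticesOf (G □ H)) (×1-homo-* (size G) (size H))

lemma4p1 : ∀ {c ℓ : Level} (R : Ring c ℓ) → Reduced R →
    (Φ : Graph → Ring.Carrier R) →
    IsInvariant R Φ → IsMultiplicative R Φ → InclusionExclusion R Φ →
    ∀ (G : Graph) → Ring._≈_ R (Φ G) (vertexCount R G)
lemma4p1 R reduced Φ invariant multiplicative incl-excl G =
  x∙y⁻¹≈ε⇒x≈y (Φ G) m (square-zero⇒zero reduced (Φ G - m) difference²≈0)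
  where
  open Ring R
  open RingProperties R using (x∙y⁻¹≈ε⇒x≈y)
  open RingFacts R
  open Consequences R Φ invariant multiplicative incl-excl
  m = vertexCount R G
  difference²≈0 : (Φ G - m) * (Φ G - m) ≈ 0#
  difference²≈0 = square-of-difference (Φ G) m
    (trans (sym (Φ-□ G G)) (Φ-product-rule G G))
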